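{- Suppose $Y\subset X=W_w(n,q)$ is an $(r,s)$-$(n,w,q,\lambda)$-design. Let $s',r'$ be nonnegative integers with $s'\le s$ and $s'\le r'\le r$. Then $m_{\mathcal R',\mathcal S'}(Y,\omega')$ takes the same value for all $\omega'\in\overline F^{s'}$ and all subsets $\mathcal S'\subset\mathcal R'\subset N$ with $|\mathcal S'|=s'$, $|\mathcal R'|=r'$, and this value is \[ \lambda_{r',s'}=(q-1)^{s-s'}\frac{\binom{n-r'}{r-r'}}{\binom{w-r'}{r-r'}}\lambda. \]
   Context: Let $q\ge 2$, $n\ge1$, $0\le w\le n$ be integers, $F=\{0,1,\ldots,q-1\}$, $\overline F=F\setminus\{0\}$, $N=\{1,\ldots,n\}$. For $x\in F^n$, $\overline x=\{i\mid x_i\ne0\}$; $X=W_w(n,q)$ is the set of $x\in F^n$ with $|\overline x|=w$. For $Y\subset X$, subsets $\mathcal{S}=\{i_1<\cdots<i_s\}\subset\mathcal{R}\subset N$ and $\omega\in\overline F^s$, put $m_{\mathcal R,\mathcal S}(Y,\omega)=|\{y\in Y\mid\mathcal R\subset\overline y,\ y_{i_j}=\omega_j\ (j=1,\ldots,s)\}|$. For integers $0\le s\le r\le w$, a subset $Y\subset X$ is an $(r,s)$-$(n,w,q,\lambda)$-design if $m_{\mathcal R,\mathcal S}(Y,\omega)=\lambda$ for all $\omega\in\overline F^s$ and all $\mathcal S\subset\mathcal R\subset N$ with $|\mathcal S|=s$, $|\mathcal R|=r$. -}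

module Defs where

open import Data.Nat using (ℕ; zero; suc)
open import Data.Bool using (Bool; true; false)
open import Data.Fin using (Fin; zero; suc)
open import Data.Fin.Properties using (_≟_)
open import Data.Fin.Subset using (Subset; _⊆_; ∣_∣; inside; outside)
open import Data.Fin.Subset.Properties using (_⊆?_)
open import Data.Vec using (Vec; []; _∷_; lookup; toList)
import Data.Vec as V
open import Data.List using (List; length; filter)
import Data.List as L
open import Data.List.Relation.Binary.Pointwise using (Pointwise)
import Data.List.Relation.Binary.Pointwise as PW
open import Data.Product using (_×_)
open import Relation.Binary.PropositionalEquality using (_≡_; _≢_)
open import Relation.Nullary using (Dec; yes; no)
open import Relation.Nullary.Decidable using (_×-dec_)

-- The alphabet F = {0,…,q-1} is Fin q; words of length n are Vec (Fin q) n.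
-- N = {1,…,n} is modelled by Fin n (0-based).

isNonzero : ∀ {q} → Fin q → Bool
isNonzero zero    = false
isNonzero (suc _) = true

support : ∀ {n q} → Vec (Fin q) n → Subset n
support = V.map isNonzero

weight : ∀ {n q} → Vec (Fin q) n → ℕ
weight x = ∣ support x ∣

elems : ∀ {n} → Subset n → List (Fin n)
elems []            = L.[]
elems (true  ∷ p)   = zero L.∷ L.map suc (elems p)
elems (false ∷ p)   = L.map suc (elems p)

Cond : ∀ {n q s} → Subset n → Subset n → Vec (Fin q) s → Vec (Fin q) n → Set
Cond R S ω y = (R ⊆ support y) × Pointwise (λ i a → lookup y i ≡ a) (elems S) (toList ω)

cond? : ∀ {n q s} (R S : Subset n) (ω : Vec (Fin q) s) (y : Vec (Fin q) n) → Dec (Cond R S ω y)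
cond? R S ω y = (R ⊆? support y) ×-dec PW.decidable (λ i a → lookup y i ≟ a) (elems S) (toList ω)

m : ∀ {n q s} → List (Vec (Fin q) n) → Subset n → Subset n → Vec (Fin q) s → ℕ
m Y R S ω = length (filter (cond? R S ω) Y)

NonzeroVec : ∀ {q s} → Vec (Fin q) s → Set
NonzeroVec {s = s} ω = ∀ (j : Fin s) → isNonzero (lookup ω j) ≡ true

-- Y ⊂ X = W_w(n,q) : every element of Y has weight w
-- (Y itself is a duplicate-free list; see Statement)
-- (r,s)-(n,w,q,λ)-design
IsDesign : ∀ {n q} (w r s lam : ℕ) → List (Vec (Fin q) n) → Set
IsDesign {n} {q} w r s lam Y =
  ∀ (R S : Subset n) (ω : Vec (Fin q) s) →
    S ⊆ R → ∣ S ∣ ≡ s → ∣ R ∣ ≡ r → NonzeroVec ω → m Y R S ω ≡ lam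

-- Generalise the queries (R, S, ω) to patterns: each coordinate is left free, required to
-- be nonzero, or required to equal a nonzero letter, and let count P be the number of words
-- of Y matching P.  Lowering s at fixed r: splitting a "nonzero" coordinate into its q − 1
-- possible letters writes count P as a sum of q − 1 counts with one more fixed letter.
-- Lowering r: a word of weight w matching P has exactly w − |R| nonzero free coordinates,
-- so summing over the n − |R| ways to require one free coordinate to be nonzero gives
-- count P · (w − |R|).  Induction on r − |R| with the absorption identity
-- (m + 1)·C(m, k) = (k + 1)·C(m + 1, k + 1) turns this into the binomial ratio.
module Submission where

open import Defs
open import Data.Nat using (ℕ; zero; suc; pred; _+_; _*_; _∸_; _^_; _≤_; _<_; s≤s; z≤n)
open import Data.Nat.Properties hiding (_≟_)
open import Data.Nat.Combinatorics using (_C_; nC1≡n; nCk+nC[k+1]≡[n+1]C[k+1])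
open import Data.Nat.Tactic.RingSolver using (solve-∀)
open import Data.Bool using (Bool; true; false; _∧_; T)
open import Data.Bool.Properties using (T-∧; ∧-assoc; ∧-comm)
open import Data.Fin using (Fin; zero; suc)
open import Data.Fin.Properties using (_≟_)
open import Data.Fin.Subset using (Subset; _⊆_; ∣_∣)
open import Data.Fin.Subset.Properties using (out⊆; in⊆in; drop-∷-⊆)
open import Data.Vec using (Vec; []; _∷_; lookup; map; toList; _[_]≔_; here)
open import Data.Vec.Properties using (map-[]≔; lookup-map; []≔-lookup)
open import Data.Vec.Functional using (Vector)
open import Data.List using (List; length; filter)
import Data.List as List
open import Data.List.Relation.Unary.All using (All)
import Data.List.Relation.Unary.All as All
open import Data.List.Relation.Unary.Unique.Propositional using (Unique)
open import Data.List.Relation.Binary.Pointwise using (Pointwise; []; _∷_)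
open import Data.List.Membership.Propositional.Properties using (∈-lookup)
open import Data.Product using (Σ-syntax; ∃; _×_; _,_; proj₁; proj₂)
open import Data.Empty using (⊥-elim)
open import Function using (_∘_; Equivalence)
open import Relation.Binary.PropositionalEquality
open import Relation.Nullary using (Dec; yes; no; does)
open import Algebra.Properties.Semiring.Sum +-*-semiring
  using (sum-syntax; sum-cong-≗; sum-replicate-zero; ∑-comm; *-distribˡ-sum; *-distribʳ-sum)

open ≡-Reasoning

[1+n]*nCk≡[1+k]*[1+n]C[1+k] : ∀ n k → suc n * (n C k) ≡ suc k * (suc n C suc k)
[1+n]*nCk≡[1+k]*[1+n]C[1+k] zero    zero    = refl
[1+n]*nCk≡[1+k]*[1+n]C[1+k] zero    (suc k) = sym (*-zeroʳ (suc (suc k)))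
[1+n]*nCk≡[1+k]*[1+n]C[1+k] (suc n) zero    =
  trans (*-identityʳ (suc (suc n))) (sym (trans (+-identityʳ _) (nC1≡n (suc (suc n)))))
[1+n]*nCk≡[1+k]*[1+n]C[1+k] (suc n) (suc k) = begin
  suc (suc n) * (suc n C suc k)
    ≡⟨ cong (suc (suc n) *_) (sym (pascal n k)) ⟩
  suc (suc n) * (n C k + n C suc k)
    ≡⟨ regroup n (n C k) (n C suc k) ⟩
  suc n * (n C k) + suc n * (n C suc k) + (n C k + n C suc k)
    ≡⟨ cong₂ _+_ (cong₂ _+_ ([1+n]*nCk≡[1+k]*[1+n]C[1+k] n k) ([1+n]*nCk≡[1+k]*[1+n]C[1+k] n (suc k)))
                 (pascal n k) ⟩
  suc k * (suc n C suc k) + suc (suc k) * (suc n C suc (suc k)) + (suc n C suc k)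
    ≡⟨ collect k (suc n C suc k) (suc n C suc (suc k)) ⟩
  suc (suc k) * (suc n C suc k + suc n C suc (suc k))
    ≡⟨ cong (suc (suc k) *_) (pascal (suc n) (suc k)) ⟩
  suc (suc k) * (suc (suc n) C suc (suc k)) ∎
  where
  pascal = nCk+nC[k+1]≡[n+1]C[k+1]
  regroup : ∀ a x y → suc (suc a) * (x + y) ≡ suc a * x + suc a * y + (x + y)
  regroup = solve-∀
  collect : ∀ d u v → suc d * u + suc (suc d) * v + u ≡ suc (suc d) * (u + v)
  collect = solve-∀

n*[n∸1]Ck≡[1+k]*nC[1+k] : ∀ n k → n * (pred n C k) ≡ suc k * (n C suc k)
n*[n∸1]Ck≡[1+k]*nC[1+k] zero    k = sym (*-zeroʳ (suc k))
n*[n∸1]Ck≡[1+k]*nC[1+k] (suc n) k = [1+n]*nCk≡[1+k]*[1+n]C[1+k] n k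

indicator : Bool → ℕ
indicator true  = 1
indicator false = 0

indicator-∧ : ∀ x y → indicator (x ∧ y) ≡ indicator x * indicator y
indicator-∧ true  y = sym (+-identityʳ (indicator y))
indicator-∧ false y = refl

indicator-*-cong : ∀ x {u v} → (T x → u ≡ v) → indicator x * u ≡ indicator x * v
indicator-*-cong true  u≡v = cong (1 *_) (u≡v _)
indicator-*-cong false u≡v = refl

∑-indicator-const : ∀ {n} (b : Fin n → Bool) {f : Fin n → ℕ} {c} → (∀ i → T (b i) → f i ≡ c) →
  ∑[ i < n ] (indicator (b i) * f i) ≡ (∑[ i < n ] indicator (b i)) * c
∑-indicator-const b {c = c} f≡c =
  trans (sum-cong-≗ (λ i → indicator-*-cong (b i) (f≡c i))) (sym (*-distribʳ-sum c (indicator ∘ b)))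

∑-const : ∀ n c → ∑[ i < n ] c ≡ n * c
∑-const zero    c = refl
∑-const (suc n) c = cong (c +_) (∑-const n c)

∑-≟≡1 : ∀ {k} (b : Fin k) → ∑[ a < k ] indicator (does (b ≟ a)) ≡ 1
∑-≟≡1 {suc k} zero    = cong suc (sum-replicate-zero k)
∑-≟≡1         (suc b) = ∑-≟≡1 b

∑-≟suc≡isNonzero : ∀ {k} (y : Fin (suc k)) →
  ∑[ a < k ] indicator (does (y ≟ suc a)) ≡ indicator (isNonzero y)
∑-≟suc≡isNonzero {k} zero    = sum-replicate-zero k
∑-≟suc≡isNonzero     (suc b) = ∑-≟≡1 b

T-does⁺ : ∀ {A : Set} (a? : Dec A) → A → T (does a?)
T-does⁺ (yes _) _ = _
T-does⁺ (no ¬a) a = ¬a a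

T-does⁻ : ∀ {A : Set} (a? : Dec A) → T (does a?) → A
T-does⁻ (yes a) _ = a

length-filter≡∑indicator : ∀ {A : Set} {P : A → Set} (P? : ∀ x → Dec (P x)) (f : A → Bool) →
  (∀ x → P x → T (f x)) → (∀ x → T (f x) → P x) → (xs : List A) →
  length (filter P? xs) ≡ ∑[ t < length xs ] indicator (f (List.lookup xs t))
length-filter≡∑indicator P? f to from List.[] = refl
length-filter≡∑indicator P? f to from (x List.∷ xs) with P? x | f x in fx
... | yes p  | true  = cong suc (length-filter≡∑indicator P? f to from xs)
... | yes p  | false = ⊥-elim (subst T fx (to x p))
... | no ¬p  | true  = ⊥-elim (¬p (from x (subst T (sym fx) _)))
... | no ¬p  | false = length-filter≡∑indicator P? f to from xs

module _ {A A′ B : Set} {R : A′ → B → Set} {f : A → A′} where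

  Pointwise-mapˡ⁺ : ∀ {xs ys} → Pointwise (λ x y → R (f x) y) xs ys → Pointwise R (List.map f xs) ys
  Pointwise-mapˡ⁺ []       = []
  Pointwise-mapˡ⁺ (r ∷ rs) = r ∷ Pointwise-mapˡ⁺ rs

  Pointwise-mapˡ⁻ : ∀ xs {ys} → Pointwise R (List.map f xs) ys → Pointwise (λ x y → R (f x) y) xs ys
  Pointwise-mapˡ⁻ List.[]       []       = []
  Pointwise-mapˡ⁻ (x List.∷ xs) (r ∷ rs) = r ∷ Pointwise-mapˡ⁻ xs rs

map-[]≔-unchanged : ∀ {A B : Set} {n} (f : A → B) (xs : Vec A n) i {x} →
  f x ≡ f (lookup xs i) → map f (xs [ i ]≔ x) ≡ map f xs
map-[]≔-unchanged f xs i {x} fx≡ = begin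
  map f (xs [ i ]≔ x)                  ≡⟨ map-[]≔ f xs i ⟩
  map f xs [ i ]≔ f x                  ≡⟨ cong (map f xs [ i ]≔_) (trans fx≡ (sym (lookup-map i f xs))) ⟩
  map f xs [ i ]≔ lookup (map f xs) i  ≡⟨ []≔-lookup (map f xs) i ⟩
  map f xs                             ∎

∣p[i]≔true∣≡1+∣p∣ : ∀ {n} (p : Subset n) i →
  lookup p i ≡ false → ∣ p [ i ]≔ true ∣ ≡ suc ∣ p ∣
∣p[i]≔true∣≡1+∣p∣ (false ∷ p) zero    refl = refl
∣p[i]≔true∣≡1+∣p∣ (true  ∷ p) (suc i) pᵢ   = cong suc (∣p[i]≔true∣≡1+∣p∣ p i pᵢ)
∣p[i]≔true∣≡1+∣p∣ (false ∷ p) (suc i) pᵢ   = ∣p[i]≔true∣≡1+∣p∣ p i pᵢ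

∣map-[]≔true∣ : ∀ {A : Set} {n} (f : A → Bool) (xs : Vec A n) i {x} →
  f x ≡ true → f (lookup xs i) ≡ false → ∣ map f (xs [ i ]≔ x) ∣ ≡ suc ∣ map f xs ∣
∣map-[]≔true∣ f xs i {x} fx fxᵢ = begin
  ∣ map f (xs [ i ]≔ x) ∣   ≡⟨ cong ∣_∣ (map-[]≔ f xs i) ⟩
  ∣ map f xs [ i ]≔ f x ∣   ≡⟨ cong (λ b → ∣ map f xs [ i ]≔ b ∣) fx ⟩
  ∣ map f xs [ i ]≔ true ∣  ≡⟨ ∣p[i]≔true∣≡1+∣p∣ (map f xs) i (trans (lookup-map i f xs) fxᵢ) ⟩
  suc ∣ map f xs ∣          ∎

-- `equals a` asks for the letter suc a, so fixed letters are nonzero by construction.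
data Constraint (k : ℕ) : Set where
  any nonzero : Constraint k
  equals      : Fin k → Constraint k

Pattern : ℕ → ℕ → Set
Pattern k n = Vec (Constraint k) n

satisfies : ∀ {k} → Constraint k → Fin (suc k) → Bool
satisfies any        y = true
satisfies nonzero    y = isNonzero y
satisfies (equals a) y = does (y ≟ suc a)

matches : ∀ {k n} → Pattern k n → Vec (Fin (suc k)) n → Bool
matches []      []       = true
matches (c ∷ P) (y ∷ ys) = satisfies c y ∧ matches P ys

isFree isConstrained isFixed : ∀ {k} → Constraint k → Bool
isFree any = true
isFree _   = false
isConstrained any = false
isConstrained _   = true
isFixed (equals _) = true
isFixed _          = false

free⇒any : ∀ {k} {c : Constraint k} → T (isFree c) → c ≡ any
free⇒any {c = any} _ = refl

constrainedSet fixedSet : ∀ {k n} → Pattern k n → Subset n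
constrainedSet = map isConstrained
fixedSet       = map isFixed

constrained fixed : ∀ {k n} → Pattern k n → ℕ
constrained P = ∣ constrainedSet P ∣
fixed       P = ∣ fixedSet P ∣

fixedLetters : ∀ {k n} (P : Pattern k n) → Vec (Fin (suc k)) (fixed P)
fixedLetters []             = []
fixedLetters (any ∷ P)      = fixedLetters P
fixedLetters (nonzero ∷ P)  = fixedLetters P
fixedLetters (equals a ∷ P) = suc a ∷ fixedLetters P

fixedSet⊆constrainedSet : ∀ {k n} (P : Pattern k n) → fixedSet P ⊆ constrainedSet P
fixedSet⊆constrainedSet []             = λ ()
fixedSet⊆constrainedSet (any ∷ P)      = out⊆ (fixedSet⊆constrainedSet P)
fixedSet⊆constrainedSet (nonzero ∷ P)  = out⊆ (fixedSet⊆constrainedSet P)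
fixedSet⊆constrainedSet (equals a ∷ P) = in⊆in (fixedSet⊆constrainedSet P)

fixedLetters-nonzero : ∀ {k n} (P : Pattern k n) → NonzeroVec (fixedLetters P)
fixedLetters-nonzero (any ∷ P)      j       = fixedLetters-nonzero P j
fixedLetters-nonzero (nonzero ∷ P)  j       = fixedLetters-nonzero P j
fixedLetters-nonzero (equals a ∷ P) zero    = refl
fixedLetters-nonzero (equals a ∷ P) (suc j) = fixedLetters-nonzero P j

profile-surjective : ∀ {k n} (R S : Subset n) (ω : Vec (Fin (suc k)) ∣ S ∣) → S ⊆ R → NonzeroVec ω →
  Σ[ P ∈ Pattern k n ] constrainedSet P ≡ R × fixedSet P ≡ S × toList (fixedLetters P) ≡ toList ω
profile-surjective []          []          []        S⊆R nz = [] , refl , refl , refl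
profile-surjective (false ∷ R) (true ∷ S)  ω         S⊆R nz with S⊆R here
... | ()
profile-surjective (true ∷ R)  (true ∷ S)  (zero ∷ ω) S⊆R nz with nz zero
... | ()
profile-surjective (true ∷ R)  (true ∷ S)  (suc a ∷ ω) S⊆R nz
  with profile-surjective R S ω (drop-∷-⊆ S⊆R) (nz ∘ suc)
... | P , refl , refl , letters = equals a ∷ P , refl , refl , cong (suc a List.∷_) letters
profile-surjective (true ∷ R)  (false ∷ S) ω         S⊆R nz
  with profile-surjective R S ω (drop-∷-⊆ S⊆R) nz
... | P , refl , refl , letters = nonzero ∷ P , refl , refl , letters
profile-surjective (false ∷ R) (false ∷ S) ω         S⊆R nz
  with profile-surjective R S ω (drop-∷-⊆ S⊆R) nz
... | P , refl , refl , letters = any ∷ P , refl , refl , letters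

matches⇒Cond : ∀ {k n} (P : Pattern k n) y →
  T (matches P y) → Cond (constrainedSet P) (fixedSet P) (fixedLetters P) y
matches⇒Cond []             []           _  = (λ ()) , []
matches⇒Cond (any ∷ P)      (y ∷ ys)     ok =
  let C⊆ , pw = matches⇒Cond P ys ok in out⊆ C⊆ , Pointwise-mapˡ⁺ pw
matches⇒Cond (nonzero ∷ P)  (suc b ∷ ys) ok =
  let C⊆ , pw = matches⇒Cond P ys ok in in⊆in C⊆ , Pointwise-mapˡ⁺ pw
matches⇒Cond (equals a ∷ P) (suc b ∷ ys) ok =
  let b≡a , ok′ = Equivalence.to (T-∧ {does (b ≟ a)}) ok
      C⊆ , pw   = matches⇒Cond P ys ok′
  in in⊆in C⊆ , T-does⁻ (suc b ≟ suc a) b≡a ∷ Pointwise-mapˡ⁺ pw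

Cond⇒matches : ∀ {k n} (P : Pattern k n) y →
  Cond (constrainedSet P) (fixedSet P) (fixedLetters P) y → T (matches P y)
Cond⇒matches []             []           _ = _
Cond⇒matches (any ∷ P)      (y ∷ ys)     (C⊆ , pw) =
  Cond⇒matches P ys (drop-∷-⊆ C⊆ , Pointwise-mapˡ⁻ _ pw)
Cond⇒matches (nonzero ∷ P)  (zero ∷ ys)  (C⊆ , pw) with C⊆ here
... | ()
Cond⇒matches (nonzero ∷ P)  (suc b ∷ ys) (C⊆ , pw) =
  Cond⇒matches P ys (drop-∷-⊆ C⊆ , Pointwise-mapˡ⁻ _ pw)
Cond⇒matches (equals a ∷ P) (y ∷ ys)     (C⊆ , refl ∷ pw) =
  Equivalence.from (T-∧ {does (a ≟ a)})
    (T-does⁺ (suc a ≟ suc a) refl , Cond⇒matches P ys (drop-∷-⊆ C⊆ , Pointwise-mapˡ⁻ _ pw))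

Cond-letters : ∀ {k n s s′} (R S : Subset n) {ω : Vec (Fin (suc k)) s} {ω′ : Vec (Fin (suc k)) s′} {y} →
  toList ω ≡ toList ω′ → Cond R S ω y → Cond R S ω′ y
Cond-letters R S letters (R⊆ , pw) = R⊆ , subst (Pointwise _ _) letters pw

m≡count : ∀ {k n s} (Y : List (Vec (Fin (suc k)) n)) (P : Pattern k n) (ω : Vec (Fin (suc k)) s) →
  toList ω ≡ toList (fixedLetters P) →
  m Y (constrainedSet P) (fixedSet P) ω ≡ ∑[ t < length Y ] indicator (matches P (List.lookup Y t))
m≡count Y P ω letters = length-filter≡∑indicator (cond? (constrainedSet P) (fixedSet P) ω) (matches P)
  (λ y c → Cond⇒matches P y (Cond-letters (constrainedSet P) (fixedSet P) letters c))
  (λ y ok → Cond-letters (constrainedSet P) (fixedSet P) (sym letters) (matches⇒Cond P y ok)) Y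

nonzero-position : ∀ {k n} (P : Pattern k n) → fixed P < constrained P → ∃ λ i → lookup P i ≡ nonzero
nonzero-position (any ∷ P)      lt       = let i , Pᵢ = nonzero-position P lt in suc i , Pᵢ
nonzero-position (nonzero ∷ P)  _        = zero , refl
nonzero-position (equals a ∷ P) (s≤s lt) = let i , Pᵢ = nonzero-position P lt in suc i , Pᵢ

module _ {k n} (P : Pattern k n) where

  constrained-[]≔equals : ∀ i {a} → lookup P i ≡ nonzero → constrained (P [ i ]≔ equals a) ≡ constrained P
  constrained-[]≔equals i Pᵢ = cong ∣_∣ (map-[]≔-unchanged isConstrained P i (cong isConstrained (sym Pᵢ)))

  fixed-[]≔equals : ∀ i {a} → lookup P i ≡ nonzero → fixed (P [ i ]≔ equals a) ≡ suc (fixed P)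
  fixed-[]≔equals i Pᵢ = ∣map-[]≔true∣ isFixed P i refl (cong isFixed Pᵢ)

  constrained-[]≔nonzero : ∀ j → lookup P j ≡ any → constrained (P [ j ]≔ nonzero) ≡ suc (constrained P)
  constrained-[]≔nonzero j Pⱼ = ∣map-[]≔true∣ isConstrained P j refl (cong isConstrained Pⱼ)

  fixed-[]≔nonzero : ∀ j → lookup P j ≡ any → fixed (P [ j ]≔ nonzero) ≡ fixed P
  fixed-[]≔nonzero j Pⱼ = cong ∣_∣ (map-[]≔-unchanged isFixed P j (cong isFixed (sym Pⱼ)))

∑-∧ˡ : ∀ {k} x (g : Fin k → Bool) →
  ∑[ a < k ] indicator (x ∧ g a) ≡ indicator x * ∑[ a < k ] indicator (g a)
∑-∧ˡ x g = trans (sum-cong-≗ (λ a → indicator-∧ x (g a)))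
                 (sym (*-distribˡ-sum (indicator x) (indicator ∘ g)))

∑-∧ʳ : ∀ {k} (g : Fin k → Bool) x →
  ∑[ a < k ] indicator (g a ∧ x) ≡ (∑[ a < k ] indicator (g a)) * indicator x
∑-∧ʳ g x = trans (sum-cong-≗ (λ a → indicator-∧ (g a) x))
                 (sym (*-distribʳ-sum (indicator x) (indicator ∘ g)))

matches-nonzero≡∑equals : ∀ {k n} (P : Pattern k n) i → lookup P i ≡ nonzero → ∀ y →
  indicator (matches P y) ≡ ∑[ a < k ] indicator (matches (P [ i ]≔ equals a) y)
matches-nonzero≡∑equals {k} (.nonzero ∷ P) zero refl (y ∷ ys) = begin
  indicator (isNonzero y ∧ matches P ys)
    ≡⟨ indicator-∧ (isNonzero y) _ ⟩
  indicator (isNonzero y) * indicator (matches P ys)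
    ≡⟨ cong (_* _) (∑-≟suc≡isNonzero y) ⟨
  (∑[ a < k ] indicator (does (y ≟ suc a))) * indicator (matches P ys)
    ≡⟨ ∑-∧ʳ {k} (λ a → does (y ≟ suc a)) _ ⟨
  ∑[ a < k ] indicator (does (y ≟ suc a) ∧ matches P ys) ∎
matches-nonzero≡∑equals {k} (c ∷ P) (suc i) Pᵢ (y ∷ ys) = begin
  indicator (satisfies c y ∧ matches P ys)
    ≡⟨ indicator-∧ (satisfies c y) _ ⟩
  indicator (satisfies c y) * indicator (matches P ys)
    ≡⟨ cong (indicator (satisfies c y) *_) (matches-nonzero≡∑equals P i Pᵢ ys) ⟩
  indicator (satisfies c y) * ∑[ a < k ] indicator (matches (P [ i ]≔ equals a) ys)
    ≡⟨ ∑-∧ˡ {k} (satisfies c y) _ ⟨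
  ∑[ a < k ] indicator (satisfies c y ∧ matches (P [ i ]≔ equals a) ys) ∎

matches-[]≔nonzero : ∀ {k n} (P : Pattern k n) j → lookup P j ≡ any → ∀ y →
  matches (P [ j ]≔ nonzero) y ≡ matches P y ∧ isNonzero (lookup y j)
matches-[]≔nonzero (.any ∷ P) zero    refl (y ∷ ys) = ∧-comm (isNonzero y) (matches P ys)
matches-[]≔nonzero (c ∷ P)    (suc j) Pⱼ   (y ∷ ys) =
  trans (cong (satisfies c y ∧_) (matches-[]≔nonzero P j Pⱼ ys)) (sym (∧-assoc (satisfies c y) _ _))

free+constrained≡n : ∀ {k n} (P : Pattern k n) →
  ∑[ j < n ] indicator (isFree (lookup P j)) + constrained P ≡ n
free+constrained≡n []             = refl
free+constrained≡n (any ∷ P)      = cong suc (free+constrained≡n P)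
free+constrained≡n (nonzero ∷ P)  = trans (+-suc _ _) (cong suc (free+constrained≡n P))
free+constrained≡n (equals a ∷ P) = trans (+-suc _ _) (cong suc (free+constrained≡n P))

freeSupport : ∀ {k n} → Pattern k n → Vec (Fin (suc k)) n → Fin n → Bool
freeSupport P y j = isFree (lookup P j) ∧ isNonzero (lookup y j)

matches⇒∑freeSupport+constrained≡weight : ∀ {k n} (P : Pattern k n) y → T (matches P y) →
  ∑[ j < n ] indicator (freeSupport P y j) + constrained P ≡ weight y
matches⇒∑freeSupport+constrained≡weight []             []           _  = refl
matches⇒∑freeSupport+constrained≡weight (any ∷ P)      (zero ∷ ys)  ok =
  matches⇒∑freeSupport+constrained≡weight P ys ok
matches⇒∑freeSupport+constrained≡weight (any ∷ P)      (suc b ∷ ys) ok =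
  cong suc (matches⇒∑freeSupport+constrained≡weight P ys ok)
matches⇒∑freeSupport+constrained≡weight (nonzero ∷ P)  (suc b ∷ ys) ok =
  trans (+-suc _ _) (cong suc (matches⇒∑freeSupport+constrained≡weight P ys ok))
matches⇒∑freeSupport+constrained≡weight (equals a ∷ P) (suc b ∷ ys) ok =
  trans (+-suc _ _) (cong suc (matches⇒∑freeSupport+constrained≡weight P ys
    (proj₂ (Equivalence.to (T-∧ {does (b ≟ a)}) ok))))

∑-[]≔nonzero : ∀ {k n} (P : Pattern k n) y →
  ∑[ j < n ] (indicator (isFree (lookup P j)) * indicator (matches (P [ j ]≔ nonzero) y))
    ≡ indicator (matches P y) * (weight y ∸ constrained P)
∑-[]≔nonzero {n = n} P y = begin
  ∑[ j < n ] (indicator (isFree (lookup P j)) * indicator (matches (P [ j ]≔ nonzero) y))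
    ≡⟨ sum-cong-≗ term ⟩
  ∑[ j < n ] (indicator (matches P y) * indicator (freeSupport P y j))
    ≡⟨ *-distribˡ-sum (indicator (matches P y)) (indicator ∘ freeSupport P y) ⟨
  indicator (matches P y) * ∑[ j < n ] indicator (freeSupport P y j)
    ≡⟨ indicator-*-cong (matches P y) (λ ok → trans (sym (m+n∸n≡m _ (constrained P)))
         (cong (_∸ constrained P) (matches⇒∑freeSupport+constrained≡weight P y ok))) ⟩
  indicator (matches P y) * (weight y ∸ constrained P) ∎
  where
  term : ∀ j → indicator (isFree (lookup P j)) * indicator (matches (P [ j ]≔ nonzero) y)
             ≡ indicator (matches P y) * indicator (freeSupport P y j)
  term j with lookup P j in Pⱼ
  ... | any      = trans (+-identityʳ _) (trans (cong indicator (matches-[]≔nonzero P j Pⱼ y))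
                                                (indicator-∧ (matches P y) _))
  ... | nonzero  = sym (*-zeroʳ (indicator (matches P y)))
  ... | equals _ = sym (*-zeroʳ (indicator (matches P y)))

module Counting {k n N : ℕ} (Y : Vector (Vec (Fin (suc k)) n) N) where

  count : Pattern k n → ℕ
  count P = ∑[ t < N ] indicator (matches P (Y t))

  count-nonzero≡∑equals : ∀ P i → lookup P i ≡ nonzero →
    count P ≡ ∑[ a < k ] count (P [ i ]≔ equals a)
  count-nonzero≡∑equals P i Pᵢ =
    trans (sum-cong-≗ (λ t → matches-nonzero≡∑equals P i Pᵢ (Y t)))
          (∑-comm (λ t a → indicator (matches (P [ i ]≔ equals a) (Y t))))

  ∑count-[]≔nonzero : ∀ {w} → (∀ t → weight (Y t) ≡ w) → ∀ P →
    ∑[ j < n ] (indicator (isFree (lookup P j)) * count (P [ j ]≔ nonzero)) ≡ count P * (w ∸ constrained P)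
  ∑count-[]≔nonzero {w} weights P = begin
    ∑[ j < n ] (indicator (isFree (lookup P j)) * count (P [ j ]≔ nonzero))
      ≡⟨ sum-cong-≗ (λ j → *-distribˡ-sum (indicator (isFree (lookup P j)))
                                          (λ t → indicator (matches (P [ j ]≔ nonzero) (Y t)))) ⟩
    ∑[ j < n ] ∑[ t < N ] (indicator (isFree (lookup P j)) * indicator (matches (P [ j ]≔ nonzero) (Y t)))
      ≡⟨ ∑-comm (λ j t → indicator (isFree (lookup P j)) * indicator (matches (P [ j ]≔ nonzero) (Y t))) ⟩
    ∑[ t < N ] ∑[ j < n ] (indicator (isFree (lookup P j)) * indicator (matches (P [ j ]≔ nonzero) (Y t)))
      ≡⟨ sum-cong-≗ (λ t → ∑-[]≔nonzero P (Y t)) ⟩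
    ∑[ t < N ] (indicator (matches P (Y t)) * (weight (Y t) ∸ constrained P))
      ≡⟨ sum-cong-≗ (λ t → cong (λ v → indicator (matches P (Y t)) * (v ∸ constrained P)) (weights t)) ⟩
    ∑[ t < N ] (indicator (matches P (Y t)) * (w ∸ constrained P))
      ≡⟨ *-distribʳ-sum (w ∸ constrained P) (λ t → indicator (matches P (Y t))) ⟨
    count P * (w ∸ constrained P) ∎

  count-fixed-descent : ∀ {r s lam} → s ≤ r →
    (∀ P → constrained P ≡ r → fixed P ≡ s → count P ≡ lam) →
    ∀ d P → constrained P ≡ r → fixed P + d ≡ s → count P ≡ k ^ d * lam
  count-fixed-descent {lam = lam} s≤r design zero P Pʳ Pˢ =
    trans (design P Pʳ (trans (sym (+-identityʳ (fixed P))) Pˢ)) (sym (+-identityʳ lam))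
  count-fixed-descent {r} {s} {lam} s≤r design (suc d) P Pʳ Pˢ = begin
    count P                                 ≡⟨ count-nonzero≡∑equals P i Pᵢ ⟩
    ∑[ a < k ] count (P [ i ]≔ equals a)    ≡⟨ sum-cong-≗ (λ a → descend a) ⟩
    ∑[ a < k ] (k ^ d * lam)                ≡⟨ ∑-const k (k ^ d * lam) ⟩
    k * (k ^ d * lam)                       ≡⟨ *-assoc k (k ^ d) lam ⟨
    k ^ suc d * lam                         ∎
    where
    fixed<constrained : fixed P < constrained P
    fixed<constrained = <-≤-trans (m<m+n (fixed P) (s≤s z≤n)) (subst₂ _≤_ (sym Pˢ) (sym Pʳ) s≤r)
    i = proj₁ (nonzero-position P fixed<constrained)
    Pᵢ = proj₂ (nonzero-position P fixed<constrained)
    descend : ∀ a → count (P [ i ]≔ equals a) ≡ k ^ d * lam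
    descend a = count-fixed-descent s≤r design d (P [ i ]≔ equals a)
      (trans (constrained-[]≔equals P i Pᵢ) Pʳ)
      (trans (cong (_+ d) (fixed-[]≔equals P i Pᵢ)) (trans (sym (+-suc (fixed P) d)) Pˢ))

  count-constrained-descent : ∀ {w r u μ} → (∀ t → weight (Y t) ≡ w) →
    (∀ P → constrained P ≡ r → fixed P ≡ u → count P ≡ μ) →
    ∀ d P → constrained P + d ≡ r → fixed P ≡ u →
    count P * ((w ∸ constrained P) C d) ≡ ((n ∸ constrained P) C d) * μ
  count-constrained-descent {μ = μ} weights design zero P Pʳ Pᵘ =
    trans (*-identityʳ (count P))
          (trans (design P (trans (sym (+-identityʳ _)) Pʳ) Pᵘ) (sym (+-identityʳ μ)))
  count-constrained-descent {w} {r} {u} {μ} weights design (suc d) P Pʳ Pᵘ =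
    *-cancelˡ-≡ _ _ (suc d) (begin
      suc d * (count P * ((w ∸ c) C suc d))
        ≡⟨ x*[y*z]≡y*[x*z] (suc d) (count P) ((w ∸ c) C suc d) ⟩
      count P * (suc d * ((w ∸ c) C suc d))
        ≡⟨ cong (count P *_) (absorb w) ⟨
      count P * ((w ∸ c) * Cʷ)
        ≡⟨ *-assoc (count P) (w ∸ c) Cʷ ⟨
      count P * (w ∸ c) * Cʷ
        ≡⟨ cong (_* Cʷ) (∑count-[]≔nonzero weights P) ⟨
      (∑[ j < n ] (free j * count (P [ j ]≔ nonzero))) * Cʷ
        ≡⟨ *-distribʳ-sum Cʷ (λ j → free j * count (P [ j ]≔ nonzero)) ⟩
      ∑[ j < n ] (free j * count (P [ j ]≔ nonzero) * Cʷ)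
        ≡⟨ sum-cong-≗ (λ j → *-assoc (free j) (count (P [ j ]≔ nonzero)) Cʷ) ⟩
      ∑[ j < n ] (free j * (count (P [ j ]≔ nonzero) * Cʷ))
        ≡⟨ ∑-indicator-const (λ j → isFree (lookup P j)) (λ j Pⱼ → descend j (free⇒any Pⱼ)) ⟩
      (∑[ j < n ] free j) * (Cⁿ * μ)
        ≡⟨ cong (_* (Cⁿ * μ)) #free ⟩
      (n ∸ c) * (Cⁿ * μ)
        ≡⟨ *-assoc (n ∸ c) Cⁿ μ ⟨
      (n ∸ c) * Cⁿ * μ
        ≡⟨ cong (_* μ) (absorb n) ⟩
      suc d * ((n ∸ c) C suc d) * μ
        ≡⟨ *-assoc (suc d) ((n ∸ c) C suc d) μ ⟩
      suc d * (((n ∸ c) C suc d) * μ) ∎)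
    where
    c = constrained P
    Cʷ = (w ∸ suc c) C d
    Cⁿ = (n ∸ suc c) C d
    free : Fin n → ℕ
    free j = indicator (isFree (lookup P j))
    x*[y*z]≡y*[x*z] : ∀ x y z → x * (y * z) ≡ y * (x * z)
    x*[y*z]≡y*[x*z] = solve-∀
    absorb : ∀ v → (v ∸ c) * ((v ∸ suc c) C d) ≡ suc d * ((v ∸ c) C suc d)
    absorb v = trans (cong (λ x → (v ∸ c) * (x C d)) (sym (pred[m∸n]≡m∸[1+n] v c)))
                     (n*[n∸1]Ck≡[1+k]*nC[1+k] (v ∸ c) d)
    #free : ∑[ j < n ] free j ≡ n ∸ c
    #free = trans (sym (m+n∸n≡m _ c)) (cong (_∸ c) (free+constrained≡n P))
    descend : ∀ j → lookup P j ≡ any → count (P [ j ]≔ nonzero) * Cʷ ≡ Cⁿ * μ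
    descend j Pⱼ = subst (λ x → count (P [ j ]≔ nonzero) * ((w ∸ x) C d) ≡ ((n ∸ x) C d) * μ) P′ʳ
      (count-constrained-descent weights design d (P [ j ]≔ nonzero)
        (trans (cong (_+ d) P′ʳ) (trans (sym (+-suc c d)) Pʳ))
        (trans (fixed-[]≔nonzero P j Pⱼ) Pᵘ))
      where P′ʳ = constrained-[]≔nonzero P j Pⱼ

design⇒count≡λ : ∀ {k n w r s lam} {Y : List (Vec (Fin (suc k)) n)} → IsDesign w r s lam Y →
  ∀ P → constrained P ≡ r → fixed P ≡ s → Counting.count (List.lookup Y) P ≡ lam
design⇒count≡λ {Y = Y} design P refl refl =
  trans (sym (m≡count Y P (fixedLetters P) refl))
        (design (constrainedSet P) (fixedSet P) (fixedLetters P) (fixedSet⊆constrainedSet P) refl refl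
                (fixedLetters-nonzero P))

proposition4p3 : (q n w : ℕ) → 2 ≤ q → 1 ≤ n → w ≤ n →
    (r s lam : ℕ) → s ≤ r → r ≤ w →
    (Y : List (Vec (Fin q) n)) → Unique Y → All (λ y → weight y ≡ w) Y →
    IsDesign w r s lam Y →
    (s' r' : ℕ) → s' ≤ s → s' ≤ r' → r' ≤ r →
    (R' S' : Subset n) (ω' : Vec (Fin q) s') →
    S' ⊆ R' → ∣ S' ∣ ≡ s' → ∣ R' ∣ ≡ r' → NonzeroVec ω' →
    m Y R' S' ω' * ((w ∸ r') C (r ∸ r'))
      ≡ (q ∸ 1) ^ (s ∸ s') * ((n ∸ r') C (r ∸ r')) * lam
proposition4p3 zero _ _ ()
proposition4p3 (suc k) n w _ _ _ r s lam s≤r _ Y _ weights design s' r' s'≤s _ r'≤r R' S' ω' S'⊆R' refl refl nz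
  with profile-surjective R' S' ω' S'⊆R' nz
... | P , refl , refl , letters = begin
  m Y (constrainedSet P) (fixedSet P) ω' * Cʷ     ≡⟨ cong (_* Cʷ) (m≡count Y P ω' (sym letters)) ⟩
  count P * Cʷ                                    ≡⟨ count-constrained-descent weightsₜ fixedDescent (r ∸ r') P
                                                       (m+[n∸m]≡n r'≤r) refl ⟩
  Cⁿ * (k ^ (s ∸ s') * lam)                       ≡⟨ *-assoc Cⁿ (k ^ (s ∸ s')) lam ⟨
  Cⁿ * k ^ (s ∸ s') * lam                         ≡⟨ cong (_* lam) (*-comm Cⁿ (k ^ (s ∸ s'))) ⟩
  k ^ (s ∸ s') * Cⁿ * lam                         ∎
  where
  open Counting (List.lookup Y)
  Cʷ = (w ∸ r') C (r ∸ r')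
  Cⁿ = (n ∸ r') C (r ∸ r')
  weightsₜ : ∀ t → weight (List.lookup Y t) ≡ w
  weightsₜ t = All.lookup weights (∈-lookup t)
  fixedDescent : ∀ P → constrained P ≡ r → fixed P ≡ s' → count P ≡ k ^ (s ∸ s') * lam
  fixedDescent P Pʳ Pˢ =
    count-fixed-descent s≤r (design⇒count≡λ {w = w} {lam = lam} {Y = Y} design) (s ∸ s') P Pʳ
    (trans (cong (_+ (s ∸ s')) Pˢ) (m+[n∸m]≡n s'≤s))
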